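{- Let $G=(A\cup B,E)$ with $|A|=|B|=n$, where each agent has a strict partial order over her neighbors. If Algorithm 1 (described in the context), run on $G$, returns a matching $M$, then $M$ is a popular assignment in $G$.
   Context: For a level function $\ell:B\to\mathbb{N}$ and $a\in A$, let $\ell^*(a)=\max_{b\in\mathsf{Nbr}(a)}\ell(b)$, where $\mathsf{Nbr}(a)$ is the set of neighbors of $a$. The graph $G_\ell=(A\cup B,E_\ell)$ contains $(a,b)\in E$ iff (i) $\ell(b)=\ell^*(a)$ and $a$ has no neighbor $b'$ with $\ell(b')=\ell^*(a)$ and $b'\succ_a b$; or (ii) $\ell(b)=\ell^*(a)-1$, $b\succ_a b'$ for every neighbor $b'$ of $a$ with $\ell(b')=\ell^*(a)$, and $a$ has no neighbor $b''$ with $\ell(b'')=\ell^*(a)-1$ and $b''\succ_a b$. Algorithm 1: set $\ell(b)=0$ for all $b\in B$; while $\ell(b)<n$ for all $b\in B$: construct $G_\ell$ and compute a maximum matching $M$ in $G_\ell$; if $M$ is perfect, return $M$; otherwise increase $\ell(b)$ by 1 for every $b\in B$ unmatched in $M$. If the loop ends, report that $G$ has no popular assignment. For matchings $M,N$, agent $a$ prefers $M$ to $N$ if $a$ is matched in $M$ and either unmatched in $N$ or $M(a)\succ_a N(a)$; $\Delta(M,N)$ is the number of agents preferring $M$ to $N$ minus the number preferring $N$ to $M$. A popular assignment is a perfect matching $M$ with $\Delta(M,N)\ge0$ for all perfect matchings $N$. -}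

module Defs where

open import Data.Nat using (ℕ; zero; suc; _≤_; _<_; _⊔_)
open import Data.Fin using (Fin)
open import Data.Bool using (Bool; true; false; if_then_else_)
open import Data.Maybe using (Maybe; just; nothing)
open import Data.List using (List; foldr)
open import Data.List using () renaming (allFin to allFinL)
open import Data.Product using (Σ; ∃; _×_; _,_)
open import Data.Sum using (_⊎_)
open import Data.Empty using (⊥)
open import Relation.Nullary using (¬_)
open import Relation.Binary.PropositionalEquality using (_≡_)

-- A bipartite graph G = (A ∪ B, E) with |A| = |B| = n; agents A = Fin n,
-- resources B = Fin n.  E a b ≡ true iff (a , b) is an edge.
Graph : ℕ → Set
Graph n = Fin n → Fin n → Bool

-- Preferences: Pref n assigns to each agent a a relation on B;
-- pref a b b' ≡ true means  b ≻_a b'.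
Pref : ℕ → Set
Pref n = Fin n → Fin n → Fin n → Bool

Nbr : {n : ℕ} → Graph n → Fin n → Fin n → Set
Nbr E a b = E a b ≡ true

Prefers : {n : ℕ} → Pref n → Fin n → Fin n → Fin n → Set
Prefers pref a b b' = pref a b b' ≡ true

module _ {n : ℕ} (E : Graph n) (pref : Pref n) where

  _≻[_]_ : Fin n → Fin n → Fin n → Set
  b ≻[ a ] b' = Prefers pref a b b'

  StrictPartialOrders : Set
  StrictPartialOrders =
    (∀ a b → Nbr E a b → ¬ (b ≻[ a ] b)) ×
    (∀ a b c d → Nbr E a b → Nbr E a c → Nbr E a d →
       b ≻[ a ] c → c ≻[ a ] d → b ≻[ a ] d)

module _ {n : ℕ} where

  Assignment : Set
  Assignment = Fin n → Maybe (Fin n)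

  IsMatching : (Fin n → Fin n → Set) → Assignment → Set
  IsMatching R M =
    (∀ a b → M a ≡ just b → R a b) ×
    (∀ a a' b → M a ≡ just b → M a' ≡ just b → a ≡ a')

  Perfect : Assignment → Set
  Perfect M = ∀ a → Σ (Fin n) λ b → M a ≡ just b

  countA : (Fin n → Bool) → ℕ
  countA p = foldr (λ a k → if p a then suc k else k) 0 (allFinL n)

  isJust : Maybe (Fin n) → Bool
  isJust (just _) = true
  isJust nothing  = false

  size : Assignment → ℕ
  size M = countA (λ a → isJust (M a))

  IsMaxMatching : (Fin n → Fin n → Set) → Assignment → Set
  IsMaxMatching R M =
    IsMatching R M × (∀ N → IsMatching R N → size N ≤ size M)

  matchedB : Assignment → Fin n → Bool
  matchedB M b = foldr (λ a r → hit (M a) r) false (allFinL n)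
    where
    open import Data.Fin using (_≟_)
    open import Relation.Nullary using (yes; no)
    hit : Maybe (Fin n) → Bool → Bool
    hit (just b') r with b' ≟ b
    ... | yes _ = true
    ... | no  _ = r
    hit nothing r = r

module _ {n : ℕ} (E : Graph n) (pref : Pref n) where

  Level : Set
  Level = Fin n → ℕ

  -- ℓ*(a) = max of ℓ over the neighbours of a (0 if a has no neighbours)
  ℓ* : Level → Fin n → ℕ
  ℓ* ℓ a = foldr (λ b k → if E a b then ℓ b ⊔ k else k) 0 (allFinL n)

  Gℓ : Level → Fin n → Fin n → Set
  Gℓ ℓ a b =
    Nbr E a b ×
    ( ( ℓ b ≡ ℓ* ℓ a ×
        ¬ (∃ λ b' → Nbr E a b' × ℓ b' ≡ ℓ* ℓ a × Prefers pref a b' b) )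
    ⊎ ( suc (ℓ b) ≡ ℓ* ℓ a ×
        (∀ b' → Nbr E a b' → ℓ b' ≡ ℓ* ℓ a → Prefers pref a b b') ×
        ¬ (∃ λ b'' → Nbr E a b'' × suc (ℓ b'') ≡ ℓ* ℓ a × Prefers pref a b'' b) ) )

  bump : Level → Assignment → Level
  bump ℓ M b = if matchedB M b then ℓ b else suc (ℓ b)

  -- Run ℓ M : the loop of Algorithm 1, started with level function ℓ,
  -- (for some choice of maximum matchings) returns M.
  data Run : Level → Assignment → Set where
    done : ∀ {ℓ M} → (∀ b → ℓ b < n) → IsMaxMatching (Gℓ ℓ) M → Perfect M → Run ℓ M
    step : ∀ {ℓ M' M} → (∀ b → ℓ b < n) → IsMaxMatching (Gℓ ℓ) M' → ¬ Perfect M' →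
           Run (bump ℓ M') M → Run ℓ M

  Algorithm1Returns : Assignment → Set
  Algorithm1Returns M = Run (λ _ → 0) M

  prefersB : Assignment → Assignment → Fin n → Bool
  prefersB M N a with M a | N a
  ... | nothing | _       = false
  ... | just b  | nothing = true
  ... | just b  | just b' = pref a b b'

  ΔNonNeg : Assignment → Assignment → Set
  ΔNonNeg M N = countA (prefersB N M) ≤ countA (prefersB M N)

  PopularAssignment : Assignment → Set
  PopularAssignment M =
    IsMatching (Nbr E) M × Perfect M ×
    (∀ N → IsMatching (Nbr E) N → Perfect N → ΔNonNeg M N)

-- Whatever the maximum matchings chosen, Algorithm 1 only returns a perfect
-- matching M of some G_ℓ.  Such an M comes with a dual certificate: for every
-- agent a and every neighbour y of a,
--     [y ≻_a M(a)] + ℓ(y) ≤ [M(a) ≻_a y] + ℓ(M(a)),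
-- because M(a) is a most preferred neighbour at level ℓ*(a), or one at level
-- ℓ*(a) − 1 beating every neighbour at level ℓ*(a).  For a perfect matching N
-- take y = N(a) and sum over all agents: M and N are both bijections A → B, so
-- the level terms on either side add up to ∑_b ℓ(b) and cancel, leaving
-- #{a : N(a) ≻_a M(a)} ≤ #{a : M(a) ≻_a N(a)}, i.e. Δ(M,N) ≥ 0.
module Submission where

open import Defs
open import Data.Nat using (ℕ; zero; suc; _+_; _≤_; _<_; _⊔_; z≤n; s≤s⁻¹)
open import Data.Nat.Properties
open import Data.Fin using (Fin; punchOut) renaming (zero to fzero; suc to fsuc)
open import Data.Fin.Properties using (any?; injective⇒≤; punchOut-injective)
  renaming (_≟_ to _≟ᶠ_)
open import Data.Fin.Permutation using (Permutation; permutation)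
open import Data.Bool using (Bool; true; false; if_then_else_)
open import Data.Maybe using (just)
open import Data.List using (List; _∷_; foldr; tabulate)
open import Data.List using () renaming (allFin to allFinL)
open import Data.List.Membership.Propositional using (_∈_)
open import Data.List.Membership.Propositional.Properties using (∈-allFin)
open import Data.List.Relation.Unary.Any using (here; there)
open import Data.Product using (∃; _×_; _,_; proj₁; proj₂)
open import Data.Sum using (inj₁; inj₂)
open import Data.Empty using (⊥-elim)
open import Relation.Nullary using (¬_; yes; no)
open import Relation.Binary.PropositionalEquality
open import Function.Definitions using (Injective; Surjective)
open import Algebra.Properties.CommutativeMonoid.Sum +-0-commutativeMonoid
  using (sum; sum-permute; ∑-distrib-+)

iverson : Bool → ℕ
iverson true  = 1
iverson false = 0

iverson≤1 : ∀ b → iverson b ≤ 1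
iverson≤1 true  = ≤-refl
iverson≤1 false = z≤n

iverson-+-mono-< : ∀ p q {m k} → m < k → iverson p + m ≤ iverson q + k
iverson-+-mono-< p q {m} {k} m<k = begin
  iverson p + m ≤⟨ +-monoˡ-≤ m (iverson≤1 p) ⟩
  suc m         ≤⟨ m<k ⟩
  k             ≤⟨ m≤n+m k (iverson q) ⟩
  iverson q + k ∎
  where open ≤-Reasoning

iverson-false-+-mono-≤ : ∀ q {m k} → m ≤ k → iverson false + m ≤ iverson q + k
iverson-false-+-mono-≤ q {m} {k} m≤k = ≤-trans m≤k (m≤n+m k (iverson q))

count-tabulate : ∀ {m n} (p : Fin m → Bool) (g : Fin n → Fin m) →
  foldr (λ a k → if p a then suc k else k) 0 (tabulate g) ≡ sum (λ i → iverson (p (g i)))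
count-tabulate {n = zero}  p g = refl
count-tabulate {n = suc n} p g with p (g fzero)
... | true  = cong suc (count-tabulate p (λ i → g (fsuc i)))
... | false = count-tabulate p (λ i → g (fsuc i))

countA≡∑iverson : ∀ {n} (p : Fin n → Bool) → countA p ≡ sum (λ a → iverson (p a))
countA≡∑iverson p = count-tabulate p (λ a → a)

∑-mono-≤ : ∀ {n} {f g : Fin n → ℕ} → (∀ i → f i ≤ g i) → sum f ≤ sum g
∑-mono-≤ {zero}  f≤g = z≤n
∑-mono-≤ {suc n} f≤g = +-mono-≤ (f≤g fzero) (∑-mono-≤ (λ i → f≤g (fsuc i)))

-- A non-surjective f would inject Fin (suc n) into Fin n by punching out the missed value.
injective⇒surjective : ∀ {n} {f : Fin n → Fin n} →
  Injective _≡_ _≡_ f → Surjective _≡_ _≡_ f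
injective⇒surjective {zero}          f-inj ()
injective⇒surjective {suc n} {f = f} f-inj b with any? (λ a → f a ≟ᶠ b)
... | yes (a , fa≡b) = a , λ { refl → fa≡b }
... | no  misses     = ⊥-elim (1+n≰n (injective⇒≤ {f = f∖b} f∖b-injective))
  where
  f∖b : Fin (suc n) → Fin n
  f∖b a = punchOut (λ b≡fa → misses (a , sym b≡fa))

  f∖b-injective : Injective _≡_ _≡_ f∖b
  f∖b-injective eq = f-inj (punchOut-injective {i = b} _ _ eq)

∑-reindex-injective : ∀ {n} (h : Fin n → ℕ) {f : Fin n → Fin n} →
  Injective _≡_ _≡_ f → sum (λ a → h (f a)) ≡ sum h
∑-reindex-injective {n} h {f} f-inj = sym (sum-permute h π)
  where
  f⁻¹ : Fin n → Fin n
  f⁻¹ b = proj₁ (injective⇒surjective f-inj b)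

  π : Permutation n n
  π = permutation f f⁻¹
    (λ b → proj₂ (injective⇒surjective f-inj b) refl)
    (λ a → f-inj (proj₂ (injective⇒surjective f-inj (f a)) refl))

module _ {n : ℕ} where

  partner : {M : Assignment} → Perfect M → Fin n → Fin n
  partner M-perfect a = proj₁ (M-perfect a)

  partner-injective : ∀ {R} {M : Assignment} → IsMatching R M → (M-perfect : Perfect M) →
    Injective _≡_ _≡_ (partner M-perfect)
  partner-injective (_ , M-functional) M-perfect {a} {a'} eq =
    M-functional a a' _ (proj₂ (M-perfect a))
      (trans (proj₂ (M-perfect a')) (cong just (sym eq)))

module _ {n : ℕ} (E : Graph n) (pref : Pref n) where

  run⇒perfect-in-Gℓ : ∀ {ℓ M} → Run E pref ℓ M →
    ∃ λ ℓ' → IsMatching (Gℓ E pref ℓ') M × Perfect M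
  run⇒perfect-in-Gℓ (done {ℓ} _ (M-matching , _) M-perfect) = ℓ , M-matching , M-perfect
  run⇒perfect-in-Gℓ (step _ _ _ run)                       = run⇒perfect-in-Gℓ run

  private
    ℓ*-list : Level E pref → Fin n → List (Fin n) → ℕ
    ℓ*-list ℓ a = foldr (λ b k → if E a b then ℓ b ⊔ k else k) 0

    ≤-ℓ*-list : ∀ ℓ a {y} (bs : List (Fin n)) → y ∈ bs → Nbr E a y →
      ℓ y ≤ ℓ*-list ℓ a bs
    ≤-ℓ*-list ℓ a {y} (b ∷ bs) (here refl) ay rewrite ay = m≤m⊔n (ℓ y) _
    ≤-ℓ*-list ℓ a (b ∷ bs) (there y∈bs) ay with E a b
    ... | true  = ≤-trans (≤-ℓ*-list ℓ a bs y∈bs ay) (m≤n⊔m (ℓ b) _)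
    ... | false = ≤-ℓ*-list ℓ a bs y∈bs ay

  ≤-ℓ* : ∀ ℓ a {y} → Nbr E a y → ℓ y ≤ ℓ* E pref ℓ a
  ≤-ℓ* ℓ a {y} = ≤-ℓ*-list ℓ a (allFinL n) (∈-allFin y)

  Certificate : Level E pref → Fin n → Fin n → Fin n → Set
  Certificate ℓ a x y = iverson (pref a y x) + ℓ y ≤ iverson (pref a x y) + ℓ x

  module _ (spo : StrictPartialOrders E pref) (ℓ : Level E pref) (a : Fin n) where

    private
      L = ℓ* E pref ℓ a

      <-ℓ* : ∀ {y} → Nbr E a y → ℓ y ≢ L → ℓ y < L
      <-ℓ* ay ℓy≢L = ≤∧≢⇒< (≤-ℓ* ℓ a ay) ℓy≢L

    top-level-certificate : ∀ {x y} → Nbr E a y → ℓ x ≡ L →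
      ¬ (∃ λ b' → Nbr E a b' × ℓ b' ≡ L × Prefers pref a b' x) → Certificate ℓ a x y
    top-level-certificate {x} {y} ay ℓx≡L x-best with ℓ y ≟ L
    ... | no ℓy≢L =
      iverson-+-mono-< (pref a y x) (pref a x y) (subst (ℓ y <_) (sym ℓx≡L) (<-ℓ* ay ℓy≢L))
    ... | yes ℓy≡L with pref a y x in y≻x
    ...   | true  = ⊥-elim (x-best (y , ay , ℓy≡L , y≻x))
    ...   | false =
      iverson-false-+-mono-≤ (pref a x y) (≤-reflexive (trans ℓy≡L (sym ℓx≡L)))

    second-level-certificate : ∀ {x y} → Nbr E a x → Nbr E a y → suc (ℓ x) ≡ L →
      (∀ b' → Nbr E a b' → ℓ b' ≡ L → Prefers pref a x b') →
      ¬ (∃ λ b'' → Nbr E a b'' × suc (ℓ b'') ≡ L × Prefers pref a b'' x) →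
      Certificate ℓ a x y
    second-level-certificate {x} {y} ax ay 1+ℓx≡L x-beats-top x-best with ℓ y ≟ L
    ... | yes ℓy≡L with x-beats-top y ay ℓy≡L | pref a y x in y≻x
    ...   | x≻y | true  = ⊥-elim (proj₁ spo a x ax (proj₂ spo a x y x ax ay ax x≻y y≻x))
    ...   | x≻y | false rewrite x≻y = ≤-reflexive (trans ℓy≡L (sym 1+ℓx≡L))
    second-level-certificate {x} {y} ax ay 1+ℓx≡L x-beats-top x-best | no ℓy≢L
      with suc (ℓ y) ≟ L
    ... | no 1+ℓy≢L =
      iverson-+-mono-< (pref a y x) (pref a x y)
        (s≤s⁻¹ (subst (suc (ℓ y) <_) (sym 1+ℓx≡L) (≤∧≢⇒< (<-ℓ* ay ℓy≢L) 1+ℓy≢L)))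
    ... | yes 1+ℓy≡L with pref a y x in y≻x
    ...   | true  = ⊥-elim (x-best (y , ay , 1+ℓy≡L , y≻x))
    ...   | false = iverson-false-+-mono-≤ (pref a x y)
                      (≤-reflexive (suc-injective (trans 1+ℓy≡L (sym 1+ℓx≡L))))

    Gℓ-certificate : ∀ {x y} → Gℓ E pref ℓ a x → Nbr E a y → Certificate ℓ a x y
    Gℓ-certificate (_  , inj₁ (ℓx≡L , x-best)) ay = top-level-certificate ay ℓx≡L x-best
    Gℓ-certificate (ax , inj₂ (1+ℓx≡L , x-beats-top , x-best)) ay =
      second-level-certificate ax ay 1+ℓx≡L x-beats-top x-best

  prefersB-just : ∀ {M N : Assignment} {a x y} → M a ≡ just x → N a ≡ just y →
    prefersB E pref M N a ≡ pref a x y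
  prefersB-just Ma≡x Na≡y rewrite Ma≡x | Na≡y = refl

  perfect-in-Gℓ⇒ΔNonNeg : StrictPartialOrders E pref → ∀ ℓ {M N} →
    IsMatching (Gℓ E pref ℓ) M → Perfect M → IsMatching (Nbr E) N → Perfect N →
    ΔNonNeg E pref M N
  perfect-in-Gℓ⇒ΔNonNeg spo ℓ {M} {N} M-matching M-perfect N-matching N-perfect =
    subst₂ _≤_ (sym (countA≡∑iverson N≻M)) (sym (countA≡∑iverson M≻N))
      (+-cancelʳ-≤ (sum ℓ) #N≻M #M≻N summed)
    where
    σ τ : Fin n → Fin n
    σ = partner M-perfect
    τ = partner N-perfect

    σ-injective : Injective _≡_ _≡_ σ
    σ-injective = partner-injective M-matching M-perfect

    τ-injective : Injective _≡_ _≡_ τ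
    τ-injective = partner-injective N-matching N-perfect

    M≻N N≻M : Fin n → Bool
    M≻N = prefersB E pref M N
    N≻M = prefersB E pref N M

    #M≻N #N≻M : ℕ
    #M≻N = sum (λ a → iverson (M≻N a))
    #N≻M = sum (λ a → iverson (N≻M a))

    pointwise : ∀ a → iverson (N≻M a) + ℓ (τ a) ≤ iverson (M≻N a) + ℓ (σ a)
    pointwise a
      rewrite prefersB-just {N} {M} (proj₂ (N-perfect a)) (proj₂ (M-perfect a))
            | prefersB-just {M} {N} (proj₂ (M-perfect a)) (proj₂ (N-perfect a)) =
      Gℓ-certificate spo ℓ a (proj₁ M-matching a (σ a) (proj₂ (M-perfect a)))
                             (proj₁ N-matching a (τ a) (proj₂ (N-perfect a)))

    summed : #N≻M + sum ℓ ≤ #M≻N + sum ℓ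
    summed = begin
      #N≻M + sum ℓ
        ≡⟨ cong (#N≻M +_) (∑-reindex-injective ℓ τ-injective) ⟨
      #N≻M + sum (λ a → ℓ (τ a))
        ≡⟨ ∑-distrib-+ (λ a → iverson (N≻M a)) (λ a → ℓ (τ a)) ⟨
      sum (λ a → iverson (N≻M a) + ℓ (τ a))
        ≤⟨ ∑-mono-≤ pointwise ⟩
      sum (λ a → iverson (M≻N a) + ℓ (σ a))
        ≡⟨ ∑-distrib-+ (λ a → iverson (M≻N a)) (λ a → ℓ (σ a)) ⟩
      #M≻N + sum (λ a → ℓ (σ a))
        ≡⟨ cong (#M≻N +_) (∑-reindex-injective ℓ σ-injective) ⟩
      #M≻N + sum ℓ ∎
      where open ≤-Reasoning

  perfect-in-Gℓ⇒popular : StrictPartialOrders E pref → ∀ ℓ {M} →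
    IsMatching (Gℓ E pref ℓ) M → Perfect M → PopularAssignment E pref M
  perfect-in-Gℓ⇒popular spo ℓ M-matching@(M-in-Gℓ , M-functional) M-perfect =
    ((λ a b Ma≡b → proj₁ (M-in-Gℓ a b Ma≡b)) , M-functional) , M-perfect ,
    λ N → perfect-in-Gℓ⇒ΔNonNeg spo ℓ M-matching M-perfect

theorem8 : (n : ℕ) (E : Graph n) (pref : Pref n) →
    StrictPartialOrders E pref →
    (M : Assignment) → Algorithm1Returns E pref M → PopularAssignment E pref M
theorem8 n E pref spo M returns
  with ℓ , M-matching , M-perfect ← run⇒perfect-in-Gℓ E pref returns
  = perfect-in-Gℓ⇒popular E pref spo ℓ M-matching M-perfect
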